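{- Let $G$ be a graph, $M$ a maximum matching of $G$, and $(H,H')\in M_2(G,M)$. Then for every path $P: m_1,h_1,m_2,\dots,m_{l-1},h_{l-1},m_l$ in $MP_o^M(M,H)$ (with $m_i\in M\setminus H$, $h_i\in H\setminus M$): (1) $m_1,m_l\in H'$; (2) $l\ge 3$.
   Context: Graphs are finite, simple. A matching is a set of pairwise non-adjacent edges. $B_2(G)$ is the set of ordered pairs $(H,H')$ of disjoint matchings; $\lambda(G)=\max\{|H|+|H'|:(H,H')\in B_2(G)\}$; $\alpha(G)=\max\{\max(|H|,|H'|):(H,H')\in B_2(G), |H|+|H'|=\lambda(G)\}$; $M_2(G)=\{(H,H')\in B_2(G):|H|+|H'|=\lambda(G), |H|=\alpha(G)\}$. For a fixed maximum matching $M$, $M_2(G,M)$ is the set of pairs $(H,H')\in M_2(G)$ maximizing $|M\cap(H\cup H')|$. For matchings $A,B$, an $A$-$B$ alternating trail has edges alternately in $A\setminus B$ and $B\setminus A$ (it is a path or an even simple cycle); an $A$-$B$ alternating path is maximal if it is not a proper subtrail of another $A$-$B$ alternating trail. $MP_o^A(A,B)$ is the set of maximal $A$-$B$ alternating paths of odd length whose first (and last) edge lies in $A$. -}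

module Defs where

open import Data.Nat using (ℕ; zero; suc; _+_; _*_; _≤_; _<_; _⊔_)
open import Data.Fin using (Fin; toℕ)
open import Data.Bool using (Bool; true; false; _∧_; _∨_; if_then_else_)
open import Data.List using (List; []; _∷_; _++_; length; map; allFin)
open import Data.Nat.ListAction using (sum)
open import Data.List.Relation.Unary.Unique.Propositional using (Unique)
open import Data.Product using (Σ; ∃; ∃-syntax; _×_; _,_)
open import Data.Sum using (_⊎_)
open import Data.Empty using (⊥)
open import Data.Unit using (⊤)
open import Relation.Nullary using (¬_; does)
open import Relation.Binary.PropositionalEquality using (_≡_)
import Data.Nat as N

record Graph (n : ℕ) : Set where
  field
    adj    : Fin n → Fin n → Bool
    sym    : ∀ i j → adj i j ≡ adj j i
    irrefl : ∀ i → adj i i ≡ false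
open Graph public

EdgeSet : ℕ → Set
EdgeSet n = Fin n → Fin n → Bool

_∩ₑ_ : ∀ {n} → EdgeSet n → EdgeSet n → EdgeSet n
(S ∩ₑ T) i j = S i j ∧ T i j

_∪ₑ_ : ∀ {n} → EdgeSet n → EdgeSet n → EdgeSet n
(S ∪ₑ T) i j = S i j ∨ T i j

IsEdgeSetOf : ∀ {n} → Graph n → EdgeSet n → Set
IsEdgeSetOf G S = (∀ i j → S i j ≡ S j i) × (∀ i j → S i j ≡ true → adj G i j ≡ true)

size : ∀ {n} → EdgeSet n → ℕ
size {n} S = sum (map (λ i → sum (map (λ j →
  if does (toℕ i N.<? toℕ j) ∧ S i j then 1 else 0) (allFin n))) (allFin n))

IsMatching : ∀ {n} → Graph n → EdgeSet n → Set
IsMatching G S = IsEdgeSetOf G S × (∀ u v w → S u v ≡ true → S u w ≡ true → v ≡ w)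

IsMaximumMatching : ∀ {n} → Graph n → EdgeSet n → Set
IsMaximumMatching G M = IsMatching G M × (∀ N → IsMatching G N → size N ≤ size M)

Disjoint : ∀ {n} → EdgeSet n → EdgeSet n → Set
Disjoint S T = ∀ i j → S i j ≡ true → T i j ≡ false

InB₂ : ∀ {n} → Graph n → EdgeSet n → EdgeSet n → Set
InB₂ G H H' = IsMatching G H × IsMatching G H' × Disjoint H H'

IsLambdaPair : ∀ {n} → Graph n → EdgeSet n → EdgeSet n → Set
IsLambdaPair G H H' = InB₂ G H H' ×
  (∀ K K' → InB₂ G K K' → size K + size K' ≤ size H + size H')

-- (H , H') ∈ M₂(G): a λ-pair with |H| = α(G), where α(G) is the maximum of
-- max(|K|,|K'|) over λ-pairs (K , K').
InM₂ : ∀ {n} → Graph n → EdgeSet n → EdgeSet n → Set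
InM₂ G H H' = IsLambdaPair G H H' ×
  (∀ K K' → IsLambdaPair G K K' → size K ⊔ size K' ≤ size H)

InM₂M : ∀ {n} → Graph n → EdgeSet n → EdgeSet n → EdgeSet n → Set
InM₂M G M H H' = InM₂ G H H' ×
  (∀ K K' → InM₂ G K K' → size (M ∩ₑ (K ∪ₑ K')) ≤ size (M ∩ₑ (H ∪ₑ H')))

AltFrom : ∀ {n} → EdgeSet n → EdgeSet n → List (Fin n) → Set
AltFrom A B []            = ⊥
AltFrom A B (u ∷ [])      = ⊤
AltFrom A B (u ∷ v ∷ vs)  = A u v ≡ true × B u v ≡ false × AltFrom B A (v ∷ vs)

IsAltSeq : ∀ {n} → EdgeSet n → EdgeSet n → List (Fin n) → Set
IsAltSeq A B vs = AltFrom A B vs ⊎ AltFrom B A vs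

Even : ℕ → Set
Even k = ∃[ m ] k ≡ 2 * m

IsAltTrail : ∀ {n} → EdgeSet n → EdgeSet n → List (Fin n) → Set
IsAltTrail A B vs = IsAltSeq A B vs ×
  (Unique vs ⊎
   Σ _ λ u → Σ (List _) λ ws → vs ≡ u ∷ ws ++ (u ∷ []) × Unique (u ∷ ws) × Even (suc (length ws)))

IsInfix : ∀ {n} → List (Fin n) → List (Fin n) → Set
IsInfix P Q = ∃[ xs ] ∃[ ys ] Q ≡ xs ++ P ++ ys

-- P is a proper subtrail of the A-B alternating trail Q (traversals of Q in
-- either direction and from any base point are themselves trails, so
-- contiguity in some traversal is captured by quantifying over all Q).
IsProperSubtrailOfSomeTrail : ∀ {n} → EdgeSet n → EdgeSet n → List (Fin n) → Set
IsProperSubtrailOfSomeTrail A B P =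
  ∃[ Q ] IsAltTrail A B Q × IsInfix P Q × length P < length Q

-- P ∈ MP_o^A(A , B): a maximal A-B alternating path of odd length whose
-- first edge lies in A (hence in A ∖ B).  P has an even number of vertices.
InMPoA : ∀ {n} → EdgeSet n → EdgeSet n → List (Fin n) → Set
InMPoA A B P = AltFrom A B P × Unique P × Even (length P) ×
  ¬ IsProperSubtrailOfSomeTrail A B P

FirstEdgeIn : ∀ {n} → EdgeSet n → List (Fin n) → Set
FirstEdgeIn S (u ∷ v ∷ _) = S u v ≡ true
FirstEdgeIn S _           = ⊥

LastEdgeIn : ∀ {n} → EdgeSet n → List (Fin n) → Set
LastEdgeIn S (u ∷ v ∷ [])    = S u v ≡ true
LastEdgeIn S (u ∷ v ∷ w ∷ r) = LastEdgeIn S (v ∷ w ∷ r)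
LastEdgeIn S _               = ⊥

module Submission where

-- The proof is a collection of local exchange arguments (only the fact that
-- M is a matching is used).  By maximality of P both endpoints of P are left
-- uncovered by H (otherwise P could be prolonged, or closed into an even
-- alternating cycle).  The optimality of (H , H') is used in three forms: no
-- disjoint pair of matchings has a larger total size, none with the same
-- total has a larger first matching, and none with the same sizes covers
-- more edges of M.  Each conclusion follows by exhibiting a modified pair
-- violating one of these:
--   * m₁ ∉ H'  : swap h₁ for m₁ in H               (more coverage of M);
--   * l = 1    : add m₁ to H, removing it from H'  (larger total / larger H);
--   * l = 2    : move m₁ , m₂ into H and h₁ into H' (larger H, same total).

open import Defs
open import Data.Nat using (ℕ; zero; suc; _+_; _*_; _≤_; _<_; _<?_; _⊔_; z≤n; s≤s)
open import Data.Nat.Properties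
  using (1+n≰n; n<1+n; +-suc; *-suc; <-asym; <-cmp; m≤m⊔n; m<m+n; suc-injective; ≤-trans)
open import Data.Nat.ListAction using (sum)
open import Data.Fin using (Fin; toℕ; _≟_)
open import Data.Fin.Properties using (toℕ-injective)
open import Data.Bool using (Bool; true; false; _∧_; _∨_; not; if_then_else_)
open import Data.Bool.Properties using (¬-not; not-¬; ∧-conicalˡ; ∧-identityʳ; ∨-identityʳ; ∨-zeroʳ; ∧-zeroʳ)
open import Data.List using (List; []; _∷_; _++_; length; map; allFin)
open import Data.List.Properties using (map-cong; map-cong-local; length-++; ++-identityʳ)
open import Data.List.Membership.Propositional using (_∈_; _∉_)
open import Data.List.Membership.Propositional.Properties using (∈-allFin)
open import Data.List.Relation.Unary.Any using (here; there)
open import Data.List.Relation.Unary.All as All using ([]; _∷_)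
open import Data.List.Relation.Unary.All.Properties using (¬Any⇒All¬)
open import Data.List.Relation.Unary.AllPairs using ([]; _∷_)
open import Data.List.Relation.Unary.Unique.Propositional using (Unique)
open import Data.List.Relation.Unary.Unique.Propositional.Properties
  using (allFin⁺; ++⁺; drop⁺; Unique[x∷xs]⇒x∉xs)
open import Data.Product using (∃-syntax; _×_; _,_; proj₁; proj₂)
open import Data.Sum using (_⊎_; inj₁; inj₂)
open import Data.Empty using (⊥; ⊥-elim)
open import Data.Unit using (⊤; tt)
open import Function using (_∘_)
open import Relation.Nullary using (Dec; yes; no; ¬_; does)
open import Relation.Nullary.Decidable using (_×-dec_; _⊎-dec_; dec-true; dec-false)
open import Relation.Binary using (tri<; tri≈; tri>)
open import Relation.Binary.PropositionalEquality
  using (_≡_; _≢_; ≢-sym; refl; trans; cong; cong₂; subst; module ≡-Reasoning)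
  renaming (sym to ≡-sym)

pairCount : ∀ {n} → EdgeSet n → Fin n → Fin n → ℕ
pairCount S i j = if does (toℕ i <? toℕ j) ∧ S i j then 1 else 0

pairCount-< : ∀ {n} (S : EdgeSet n) {i j : Fin n} → toℕ i < toℕ j →
  pairCount S i j ≡ (if S i j then 1 else 0)
pairCount-< S {i} {j} i<j rewrite dec-true (toℕ i <? toℕ j) i<j = refl

pairCount-≮ : ∀ {n} (S : EdgeSet n) {i j : Fin n} → ¬ toℕ i < toℕ j → pairCount S i j ≡ 0
pairCount-≮ S {i} {j} i≮j rewrite dec-false (toℕ i <? toℕ j) i≮j = refl

sum-bump : ∀ {A : Set} (xs : List A) (f g : A → ℕ) (x₀ : A) → Unique xs → x₀ ∈ xs →
  (∀ x → x ≢ x₀ → f x ≡ g x) → g x₀ ≡ suc (f x₀) → sum (map g xs) ≡ suc (sum (map f xs))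
sum-bump (x ∷ xs) f g .x (x∉xs ∷ _) (here refl) agree bump =
  cong₂ _+_ bump (≡-sym (cong sum (map-cong-local (All.map (λ x≢y → agree _ (x≢y ∘ ≡-sym)) x∉xs))))
sum-bump (y ∷ xs) f g x₀ (y∉xs ∷ unique) (there x₀∈xs) agree bump = begin
  g y + sum (map g xs)       ≡⟨ cong₂ _+_ (≡-sym (agree y (All.lookup y∉xs x₀∈xs)))
                                          (sum-bump xs f g x₀ unique x₀∈xs agree bump) ⟩
  f y + suc (sum (map f xs)) ≡⟨ +-suc (f y) _ ⟩
  suc (f y + sum (map f xs)) ∎
  where open ≡-Reasoning

size-bump : ∀ {n} (S T : EdgeSet n) (p q : Fin n) →
  (∀ i j → ¬ (i ≡ p × j ≡ q) → pairCount S i j ≡ pairCount T i j) →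
  pairCount T p q ≡ suc (pairCount S p q) → size T ≡ suc (size S)
size-bump {n} S T p q agree bump =
  sum-bump (allFin n) (λ i → sum (map (pairCount S i) (allFin n)))
    (λ i → sum (map (pairCount T i) (allFin n))) p (allFin⁺ n) (∈-allFin p)
    (λ i i≢p → cong sum (map-cong (λ j → agree i j (i≢p ∘ proj₁)) (allFin n)))
    (sum-bump (allFin n) (pairCount S p) (pairCount T p) q (allFin⁺ n) (∈-allFin q)
      (λ j j≢q → agree p j (j≢q ∘ proj₂)) bump)

SameEdge : ∀ {n} → Fin n → Fin n → Fin n → Fin n → Set
SameEdge u v i j = (i ≡ u × j ≡ v) ⊎ (i ≡ v × j ≡ u)

sameEdge? : ∀ {n} (u v i j : Fin n) → Dec (SameEdge u v i j)
sameEdge? u v i j = ((i ≟ u) ×-dec (j ≟ v)) ⊎-dec ((i ≟ v) ×-dec (j ≟ u))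

SameEdge-swap : ∀ {n} {u v i j : Fin n} → SameEdge u v i j → SameEdge v u i j
SameEdge-swap (inj₁ e) = inj₂ e
SameEdge-swap (inj₂ e) = inj₁ e

SameEdge-flip : ∀ {n} {u v i j : Fin n} → SameEdge u v i j → SameEdge u v j i
SameEdge-flip (inj₁ (i≡u , j≡v)) = inj₂ (j≡v , i≡u)
SameEdge-flip (inj₂ (i≡v , j≡u)) = inj₁ (j≡u , i≡v)

not-endpointˡ : ∀ {n} {u v i j : Fin n} → i ≢ u → i ≢ v → ¬ SameEdge u v i j
not-endpointˡ i≢u i≢v (inj₁ (i≡u , _)) = i≢u i≡u
not-endpointˡ i≢u i≢v (inj₂ (i≡v , _)) = i≢v i≡v

not-endpointʳ : ∀ {n} {u v i j : Fin n} → j ≢ u → j ≢ v → ¬ SameEdge u v i j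
not-endpointʳ j≢u j≢v = not-endpointˡ j≢v j≢u ∘ SameEdge-flip ∘ SameEdge-swap

edgeAt : ∀ {n} → Fin n → Fin n → EdgeSet n
edgeAt u v i j with sameEdge? u v i j
... | yes _ = true
... | no _  = false

edgeAt-on : ∀ {n} {u v i j : Fin n} → SameEdge u v i j → edgeAt u v i j ≡ true
edgeAt-on {u = u} {v} {i} {j} same with sameEdge? u v i j
... | yes _    = refl
... | no other = ⊥-elim (other same)

edgeAt-off : ∀ {n} {u v i j : Fin n} → ¬ SameEdge u v i j → edgeAt u v i j ≡ false
edgeAt-off {u = u} {v} {i} {j} other with sameEdge? u v i j
... | yes same = ⊥-elim (other same)
... | no _     = refl

edgeAt-sound : ∀ {n} {u v i j : Fin n} → edgeAt u v i j ≡ true → SameEdge u v i j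
edgeAt-sound {u = u} {v} {i} {j} e with sameEdge? u v i j
... | yes same = same

edgeAt-sym : ∀ {n} (u v i j : Fin n) → edgeAt u v i j ≡ edgeAt u v j i
edgeAt-sym u v i j with sameEdge? u v i j
... | yes same = ≡-sym (edgeAt-on (SameEdge-flip same))
... | no other = ≡-sym (edgeAt-off (other ∘ SameEdge-flip))

edge-step-< : ∀ {n} (S T : EdgeSet n) (u v : Fin n) → toℕ u < toℕ v → S u v ≡ false → T u v ≡ true →
  (∀ i j → ¬ SameEdge u v i j → S i j ≡ T i j) → size T ≡ suc (size S)
edge-step-< S T u v u<v Suv Tuv agree = size-bump S T u v counts bump
  where
  bump : pairCount T u v ≡ suc (pairCount S u v)
  bump rewrite pairCount-< T u<v | pairCount-< S u<v | Suv | Tuv = refl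
  counts : ∀ i j → ¬ (i ≡ u × j ≡ v) → pairCount S i j ≡ pairCount T i j
  counts i j not-uv with toℕ i <? toℕ j
  ... | no i≮j rewrite pairCount-≮ S i≮j | pairCount-≮ T i≮j = refl
  ... | yes i<j with sameEdge? u v i j
  ...   | yes (inj₁ uv) = ⊥-elim (not-uv uv)
  ...   | yes (inj₂ (refl , refl)) = ⊥-elim (<-asym u<v i<j)
  ...   | no other rewrite pairCount-< S i<j | pairCount-< T i<j | agree i j other = refl

edge-step : ∀ {n} (S T : EdgeSet n) (u v : Fin n) → u ≢ v →
  S u v ≡ false → S v u ≡ false → T u v ≡ true → T v u ≡ true →
  (∀ i j → ¬ SameEdge u v i j → S i j ≡ T i j) → size T ≡ suc (size S)
edge-step S T u v u≢v Suv Svu Tuv Tvu agree with <-cmp (toℕ u) (toℕ v)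
... | tri< u<v _ _ = edge-step-< S T u v u<v Suv Tuv agree
... | tri≈ _ u≡v _ = ⊥-elim (u≢v (toℕ-injective u≡v))
... | tri> _ _ v<u = edge-step-< S T v u v<u Svu Tvu (λ i j other → agree i j (other ∘ SameEdge-swap))

Symmetric : ∀ {n} → EdgeSet n → Set
Symmetric S = ∀ i j → S i j ≡ S j i

Uncovered : ∀ {n} → EdgeSet n → Fin n → Set
Uncovered S u = ∀ z → S u z ≡ false

insert : ∀ {n} → Fin n → Fin n → EdgeSet n → EdgeSet n
insert u v S = S ∪ₑ edgeAt u v

remove : ∀ {n} → Fin n → Fin n → EdgeSet n → EdgeSet n
remove u v S i j = S i j ∧ not (edgeAt u v i j)

insert-present : ∀ {n} (S : EdgeSet n) {u v i j : Fin n} → SameEdge u v i j → insert u v S i j ≡ true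
insert-present S {i = i} {j} same rewrite edgeAt-on same = ∨-zeroʳ (S i j)

insert-absent : ∀ {n} (S : EdgeSet n) {u v i j : Fin n} → ¬ SameEdge u v i j → S i j ≡ false →
  insert u v S i j ≡ false
insert-absent S other Sij rewrite edgeAt-off other | Sij = refl

remove-present : ∀ {n} (S : EdgeSet n) {u v i j : Fin n} → ¬ SameEdge u v i j → S i j ≡ true →
  remove u v S i j ≡ true
remove-present S other Sij rewrite edgeAt-off other | Sij = refl

remove-absent : ∀ {n} (S : EdgeSet n) {u v i j : Fin n} → SameEdge u v i j → remove u v S i j ≡ false
remove-absent S {i = i} {j} same rewrite edgeAt-on same = ∧-zeroʳ (S i j)

remove-keeps-absent : ∀ {n} (S : EdgeSet n) (u v : Fin n) {i j : Fin n} → S i j ≡ false →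
  remove u v S i j ≡ false
remove-keeps-absent S u v Sij rewrite Sij = refl

insert-size : ∀ {n} (S : EdgeSet n) (u v : Fin n) → Symmetric S → u ≢ v → S u v ≡ false →
  size (insert u v S) ≡ suc (size S)
insert-size S u v symm u≢v Suv =
  edge-step S (insert u v S) u v u≢v Suv (trans (symm v u) Suv)
    (insert-present S (inj₁ (refl , refl))) (insert-present S (inj₂ (refl , refl)))
    (λ i j other → ≡-sym (trans (cong (S i j ∨_) (edgeAt-off other)) (∨-identityʳ (S i j))))

remove-size : ∀ {n} (S : EdgeSet n) (u v : Fin n) → Symmetric S → u ≢ v → S u v ≡ true →
  size S ≡ suc (size (remove u v S))
remove-size S u v symm u≢v Suv =
  edge-step (remove u v S) S u v u≢v
    (remove-absent S (inj₁ (refl , refl))) (remove-absent S (inj₂ (refl , refl)))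
    Suv (trans (symm v u) Suv)
    (λ i j other → trans (cong (λ e → S i j ∧ not e) (edgeAt-off other)) (∧-identityʳ (S i j)))

insert-symmetric : ∀ {n} (S : EdgeSet n) (u v : Fin n) → Symmetric S → Symmetric (insert u v S)
insert-symmetric S u v symm i j = cong₂ _∨_ (symm i j) (edgeAt-sym u v i j)

remove-symmetric : ∀ {n} (S : EdgeSet n) (u v : Fin n) → Symmetric S → Symmetric (remove u v S)
remove-symmetric S u v symm i j = cong₂ (λ s e → s ∧ not e) (symm i j) (edgeAt-sym u v i j)

remove-uncovered : ∀ {n} (S : EdgeSet n) (u v w : Fin n) → Uncovered S w → Uncovered (remove u v S) w
remove-uncovered S u v w free z = remove-keeps-absent S u v (free z)

insert-uncovered : ∀ {n} (S : EdgeSet n) (u v w : Fin n) → Uncovered S w → w ≢ u → w ≢ v →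
  Uncovered (insert u v S) w
insert-uncovered S u v w free w≢u w≢v z = insert-absent S (not-endpointˡ w≢u w≢v) (free z)

disjoint-sym : ∀ {n} {S T : EdgeSet n} → Disjoint S T → Disjoint T S
disjoint-sym {S = S} disj i j Tij with S i j in Sij
... | false = refl
... | true  with () ← trans (≡-sym Tij) (disj i j Sij)

insert-disjointˡ : ∀ {n} (S T : EdgeSet n) (u v : Fin n) → Disjoint S T →
  T u v ≡ false → T v u ≡ false → Disjoint (insert u v S) T
insert-disjointˡ S T u v disj Tuv Tvu i j e with S i j in Sij
... | true = disj i j Sij
... | false with edgeAt-sound {u = u} {v} {i} {j} e
...   | inj₁ (refl , refl) = Tuv
...   | inj₂ (refl , refl) = Tvu

insert-disjointʳ : ∀ {n} (S T : EdgeSet n) (u v : Fin n) → Disjoint S T →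
  S u v ≡ false → S v u ≡ false → Disjoint S (insert u v T)
insert-disjointʳ S T u v disj Suv Svu =
  disjoint-sym (insert-disjointˡ T S u v (disjoint-sym disj) Suv Svu)

remove-disjointˡ : ∀ {n} (S T : EdgeSet n) (u v : Fin n) → Disjoint S T → Disjoint (remove u v S) T
remove-disjointˡ S T u v disj i j e with S i j in Sij
... | true = disj i j Sij

remove-disjointʳ : ∀ {n} (S T : EdgeSet n) (u v : Fin n) → Disjoint S T → Disjoint S (remove u v T)
remove-disjointʳ S T u v disj = disjoint-sym (remove-disjointˡ T S u v (disjoint-sym disj))

module Matching {n} (G : Graph n) (S : EdgeSet n) (matching : IsMatching G S) where

  symmetric : Symmetric S
  symmetric = proj₁ (proj₁ matching)

  adjacent : ∀ i j → S i j ≡ true → adj G i j ≡ true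
  adjacent = proj₂ (proj₁ matching)

  partner-unique : ∀ u v w → S u v ≡ true → S u w ≡ true → v ≡ w
  partner-unique = proj₂ matching

  flip : ∀ {u v} → S u v ≡ true → S v u ≡ true
  flip {u} {v} Suv = trans (symmetric v u) Suv

  flip-absent : ∀ {u v} → S u v ≡ false → S v u ≡ false
  flip-absent {u} {v} Suv = trans (symmetric v u) Suv

  -- Graphs have no loops, so edges join distinct vertices.
  ends-distinct : ∀ {u v} → S u v ≡ true → u ≢ v
  ends-distinct {u} Suv refl with () ← trans (≡-sym (adjacent u u Suv)) (irrefl G u)

  other-absent : ∀ {u v w} → S u v ≡ true → w ≢ v → S u w ≡ false
  other-absent {u} {v} {w} Suv w≢v with S u w in Suw
  ... | false = refl
  ... | true  = ⊥-elim (w≢v (≡-sym (partner-unique u v w Suv Suw)))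

  size-after-insert : ∀ {u v} → u ≢ v → S u v ≡ false → size (insert u v S) ≡ suc (size S)
  size-after-insert {u} {v} = insert-size S u v symmetric

  size-before-remove : ∀ {u v} → S u v ≡ true → size S ≡ suc (size (remove u v S))
  size-before-remove {u} {v} Suv = remove-size S u v symmetric (ends-distinct Suv) Suv

  covered : ∀ {u v} → S u v ≡ true → ¬ Uncovered S u
  covered {u} {v} Suv free with () ← trans (≡-sym Suv) (free v)

  remove-matching : ∀ u v → IsMatching G (remove u v S)
  remove-matching u v =
    (remove-symmetric S u v symmetric , (λ i j e → adjacent i j (∧-conicalˡ _ _ e))) ,
    (λ x y z e₁ e₂ → partner-unique x y z (∧-conicalˡ _ _ e₁) (∧-conicalˡ _ _ e₂))

  remove-frees : ∀ {u v} → S u v ≡ true → Uncovered (remove u v S) u × Uncovered (remove u v S) v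
  remove-frees {u} {v} Suv = frees-u , frees-v
    where
    frees-u : Uncovered (remove u v S) u
    frees-u z = by-cases (z ≟ v)
      where
      by-cases : Dec (z ≡ v) → remove u v S u z ≡ false
      by-cases (yes refl) = remove-absent S (inj₁ (refl , refl))
      by-cases (no z≢v)   = remove-keeps-absent S u v (other-absent Suv z≢v)
    frees-v : Uncovered (remove u v S) v
    frees-v z = by-cases (z ≟ u)
      where
      by-cases : Dec (z ≡ u) → remove u v S v z ≡ false
      by-cases (yes refl) = remove-absent S (inj₂ (refl , refl))
      by-cases (no z≢u)   = remove-keeps-absent S u v (other-absent (flip Suv) z≢u)

  insert-matching : ∀ {u v} → adj G u v ≡ true → Uncovered S u → Uncovered S v →
    IsMatching G (insert u v S)
  insert-matching {u} {v} Guv free-u free-v =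
    (insert-symmetric S u v symmetric , edges) , partners
    where
    edges : ∀ i j → insert u v S i j ≡ true → adj G i j ≡ true
    edges i j e with S i j in Sij
    ... | true = adjacent i j Sij
    ... | false with edgeAt-sound {u = u} {v} {i} {j} e
    ...   | inj₁ (refl , refl) = Guv
    ...   | inj₂ (refl , refl) = trans (Graph.sym G i j) Guv
    new-end-free : ∀ {x y} → SameEdge u v x y → Uncovered S x
    new-end-free (inj₁ (refl , _)) = free-u
    new-end-free (inj₂ (refl , _)) = free-v
    partners : ∀ x y z → insert u v S x y ≡ true → insert u v S x z ≡ true → y ≡ z
    partners x y z e₁ e₂ with S x y in Sxy | S x z in Sxz
    ... | true  | true  = partner-unique x y z Sxy Sxz
    ... | true  | false = ⊥-elim (covered Sxy (new-end-free (edgeAt-sound {u = u} {v} {x} {z} e₂)))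
    ... | false | true  = ⊥-elim (covered Sxz (new-end-free (edgeAt-sound {u = u} {v} {x} {y} e₁)))
    ... | false | false with edgeAt-sound {u = u} {v} {x} {y} e₁ | edgeAt-sound {u = u} {v} {x} {z} e₂
    ...   | inj₁ (refl , refl) | inj₁ (refl , refl) = refl
    ...   | inj₂ (refl , refl) | inj₂ (refl , refl) = refl
    ...   | inj₁ (refl , refl) | inj₂ (refl , refl) = refl
    ...   | inj₂ (refl , refl) | inj₁ (refl , refl) = refl

module Optimal {n} (G : Graph n) (M H H' : EdgeSet n) (optimal : InM₂M G M H H') where

  λ-pair : IsLambdaPair G H H'
  λ-pair = proj₁ (proj₁ optimal)

  in-B₂ : InB₂ G H H'
  in-B₂ = proj₁ λ-pair

  same-total-λ-pair : ∀ {K K'} → InB₂ G K K' → size K + size K' ≡ size H + size H' →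
    IsLambdaPair G K K'
  same-total-λ-pair kk total =
    kk , λ L L' ll → subst (size L + size L' ≤_) (≡-sym total) (proj₂ λ-pair L L' ll)

  no-larger-total : ∀ {K K'} → InB₂ G K K' → size K + size K' ≡ suc (size H + size H') → ⊥
  no-larger-total {K} {K'} kk total =
    1+n≰n (subst (_≤ size H + size H') total (proj₂ λ-pair K K' kk))

  no-larger-first : ∀ {K K'} → InB₂ G K K' → size K + size K' ≡ size H + size H' →
    size K ≡ suc (size H) → ⊥
  no-larger-first {K} {K'} kk total first = 1+n≰n (subst (_≤ size H) first
    (≤-trans (m≤m⊔n (size K) (size K')) (proj₂ (proj₁ optimal) K K' (same-total-λ-pair kk total))))

  no-better-coverage : ∀ {K K'} → InB₂ G K K' → size K ≡ size H → size K' ≡ size H' →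
    size (M ∩ₑ (K ∪ₑ K')) ≡ suc (size (M ∩ₑ (H ∪ₑ H'))) → ⊥
  no-better-coverage {K} {K'} kk first second coverage =
    1+n≰n (subst (_≤ size (M ∩ₑ (H ∪ₑ H'))) coverage (proj₂ optimal K K' (kk-λ , kk-α)))
    where
    kk-λ : IsLambdaPair G K K'
    kk-λ = same-total-λ-pair kk (cong₂ _+_ first second)
    kk-α : ∀ L L' → IsLambdaPair G L L' → size L ⊔ size L' ≤ size K
    kk-α L L' ll = subst (size L ⊔ size L' ≤_) (≡-sym first) (proj₂ (proj₁ optimal) L L' ll)

module Exchange {n} (G : Graph n) (M H H' : EdgeSet n)
  (M-matching : IsMatching G M) (optimal : InM₂M G M H H') where

  open Optimal G M H H' optimal
  private
    H-matching : IsMatching G H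
    H-matching = proj₁ in-B₂
    H'-matching : IsMatching G H'
    H'-matching = proj₁ (proj₂ in-B₂)
    H-H'-disjoint : Disjoint H H'
    H-H'-disjoint = proj₂ (proj₂ in-B₂)
    module ℳ  = Matching G M M-matching
    module ℋ  = Matching G H H-matching
    module ℋ' = Matching G H' H'-matching

  swap-gains-coverage : ∀ {a b c} → M a b ≡ true → M b c ≡ false → Uncovered H a → H' a b ≡ false →
    size (M ∩ₑ (insert a b (remove b c H) ∪ₑ H')) ≡ suc (size (M ∩ₑ (H ∪ₑ H')))
  swap-gains-coverage {a} {b} {c} Mab M-bc free-a H'ab =
    edge-step X Y a b (ℳ.ends-distinct Mab) X-ab X-ba Y-ab Y-ba agree
    where
    X Y : EdgeSet n
    X = M ∩ₑ (H ∪ₑ H')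
    Y = M ∩ₑ (insert a b (remove b c H) ∪ₑ H')
    X-ab : X a b ≡ false
    X-ab rewrite Mab | free-a b | H'ab = refl
    X-ba : X b a ≡ false
    X-ba rewrite ℳ.flip Mab | ℋ.flip-absent (free-a b) | ℋ'.flip-absent H'ab = refl
    Y-ab : Y a b ≡ true
    Y-ab rewrite Mab | free-a b | edgeAt-on {u = a} {b} {a} {b} (inj₁ (refl , refl)) = refl
    Y-ba : Y b a ≡ true
    Y-ba rewrite ℳ.flip Mab | ℋ.flip-absent (free-a b) | edgeAt-on {u = a} {b} {b} {a} (inj₂ (refl , refl)) = refl
    -- away from ab, Y differs from X at most on bc, which is not in M
    agree : ∀ i j → ¬ SameEdge a b i j → X i j ≡ Y i j
    agree i j not-ab = by-cases (sameEdge? b c i j)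
      where
      by-cases : Dec (SameEdge b c i j) → X i j ≡ Y i j
      by-cases (yes (inj₁ (refl , refl))) rewrite M-bc = refl
      by-cases (yes (inj₂ (refl , refl))) rewrite ℳ.flip-absent M-bc = refl
      by-cases (no not-bc) rewrite edgeAt-off not-bc | edgeAt-off not-ab
        | ∧-identityʳ (H i j) | ∨-identityʳ (H i j) = refl

  -- If ab ∈ M, bc ∈ H and a is H-free, then ab ∈ H': otherwise replacing bc
  -- by ab in H keeps all sizes and covers one more edge of M.
  pendant-in-H' : ∀ {a b c} → M a b ≡ true → H b c ≡ true → Uncovered H a → H' a b ≡ true
  pendant-in-H' {a} {b} {c} Mab Hbc free-a with H' a b in H'ab
  ... | true  = refl
  ... | false = ⊥-elim (no-better-coverage (K-matching , H'-matching , K-disjoint) K-size refl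
                         (swap-gains-coverage Mab M-bc free-a H'ab))
    where
    K : EdgeSet n
    K = insert a b (remove b c H)
    K-matching : IsMatching G K
    K-matching = Matching.insert-matching G (remove b c H) (ℋ.remove-matching b c)
      (ℳ.adjacent a b Mab) (remove-uncovered H b c a free-a) (proj₁ (ℋ.remove-frees Hbc))
    K-disjoint : Disjoint K H'
    K-disjoint = insert-disjointˡ (remove b c H) H' a b (remove-disjointˡ H H' b c H-H'-disjoint)
      H'ab (ℋ'.flip-absent H'ab)
    K-size : size K ≡ size H
    K-size = trans (Matching.size-after-insert G (remove b c H) (ℋ.remove-matching b c)
                      (ℳ.ends-distinct Mab) (remove-keeps-absent H b c (free-a b)))
                   (≡-sym (ℋ.size-before-remove Hbc))
    -- bc is not an M-edge, since b is M-matched to a ≠ c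
    M-bc : M b c ≡ false
    M-bc = ℳ.other-absent (ℳ.flip Mab) (λ { refl → ℋ.covered (ℋ.flip Hbc) free-a })

  -- No M-edge has both ends H-free: adding it to H (and removing it from H'
  -- if it lies there) increases the total size or the size of H.
  no-free-M-edge : ∀ {a b} → M a b ≡ true → Uncovered H a → Uncovered H b → ⊥
  no-free-M-edge {a} {b} Mab free-a free-b = by-cases (H' a b) refl
    where
    K : EdgeSet n
    K = insert a b H
    K-matching : IsMatching G K
    K-matching = ℋ.insert-matching (ℳ.adjacent a b Mab) free-a free-b
    K-size : size K ≡ suc (size H)
    K-size = ℋ.size-after-insert (ℳ.ends-distinct Mab) (free-a b)
    by-cases : (x : Bool) → H' a b ≡ x → ⊥
    by-cases false H'ab =
      no-larger-total (K-matching , H'-matching , K-disjoint) (cong (_+ size H') K-size)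
      where
      K-disjoint : Disjoint K H'
      K-disjoint = insert-disjointˡ H H' a b H-H'-disjoint H'ab (ℋ'.flip-absent H'ab)
    by-cases true H'ab = no-larger-first (K-matching , ℋ'.remove-matching a b , K-disjoint) total K-size
      where
      K-disjoint : Disjoint K (remove a b H')
      K-disjoint = insert-disjointˡ H (remove a b H') a b (remove-disjointʳ H H' a b H-H'-disjoint)
        (remove-absent H' (inj₁ (refl , refl))) (remove-absent H' (inj₂ (refl , refl)))
      total : size K + size (remove a b H') ≡ size H + size H'
      total rewrite K-size | ℋ'.size-before-remove H'ab = ≡-sym (+-suc (size H) _)

  -- The rotation along a path a b c d with ab , cd ∈ M, bc ∈ H and a , d
  -- H-free: by pendant-in-H' both M-edges lie in H', and the pair
  --   K = H - bc + ab + cd ,  K' = H' - ab - cd + bc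
  -- is in B₂(G) with the same total size but |K| = |H| + 1.
  module Rotation {a b c d} (Mab : M a b ≡ true) (Hbc : H b c ≡ true) (Mcd : M c d ≡ true)
    (free-a : Uncovered H a) (free-d : Uncovered H d) where

    H'ab : H' a b ≡ true
    H'ab = pendant-in-H' Mab Hbc free-a
    H'cd : H' c d ≡ true
    H'cd = ℋ'.flip (pendant-in-H' (ℳ.flip Mcd) (ℋ.flip Hbc) free-d)

    a≢b : a ≢ b
    a≢b = ℳ.ends-distinct Mab
    b≢c : b ≢ c
    b≢c = ℋ.ends-distinct Hbc
    c≢d : c ≢ d
    c≢d = ℳ.ends-distinct Mcd
    a≢c : a ≢ c
    a≢c refl = ℋ.covered (ℋ.flip Hbc) free-a
    b≢d : b ≢ d
    b≢d refl = ℋ.covered Hbc free-d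
    a≢d : a ≢ d
    a≢d refl = b≢c (ℋ'.partner-unique a b c H'ab (ℋ'.flip H'cd))

    K₀ K₁ K : EdgeSet n
    K₀ = remove b c H
    K₁ = insert a b K₀
    K  = insert c d K₁
    module 𝒦₀ = Matching G K₀ (ℋ.remove-matching b c)

    K₁-matching : IsMatching G K₁
    K₁-matching = 𝒦₀.insert-matching (ℳ.adjacent a b Mab)
      (remove-uncovered H b c a free-a) (proj₁ (ℋ.remove-frees Hbc))

    K-matching : IsMatching G K
    K-matching = Matching.insert-matching G K₁ K₁-matching (ℳ.adjacent c d Mcd)
      (insert-uncovered K₀ a b c (proj₂ (ℋ.remove-frees Hbc)) (≢-sym a≢c) (≢-sym b≢c))
      (insert-uncovered K₀ a b d (remove-uncovered H b c d free-d) (≢-sym a≢d) (≢-sym b≢d))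

    K-size : size K ≡ suc (size H)
    K-size = begin
      size K            ≡⟨ Matching.size-after-insert G K₁ K₁-matching c≢d K₁-cd ⟩
      suc (size K₁)     ≡⟨ cong suc (𝒦₀.size-after-insert a≢b (remove-keeps-absent H b c (free-a b))) ⟩
      suc (suc (size K₀)) ≡⟨ cong suc (≡-sym (ℋ.size-before-remove Hbc)) ⟩
      suc (size H)      ∎
      where
      open ≡-Reasoning
      K₁-cd : K₁ c d ≡ false
      K₁-cd = insert-absent K₀ (not-endpointˡ (≢-sym a≢c) (≢-sym b≢c))
        (remove-keeps-absent H b c (ℋ.other-absent (ℋ.flip Hbc) (≢-sym b≢d)))

    L₀ L K' : EdgeSet n
    L₀ = remove a b H'
    L  = remove c d L₀
    K' = insert b c L
    module ℒ₀ = Matching G L₀ (ℋ'.remove-matching a b)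

    L₀-cd : L₀ c d ≡ true
    L₀-cd = remove-present H' (not-endpointˡ (≢-sym a≢c) (≢-sym b≢c)) H'cd

    L-matching : IsMatching G L
    L-matching = ℒ₀.remove-matching c d

    K'-matching : IsMatching G K'
    K'-matching = Matching.insert-matching G L L-matching (ℋ.adjacent b c Hbc)
      (remove-uncovered L₀ c d b (proj₂ (ℋ'.remove-frees H'ab))) (proj₁ (ℒ₀.remove-frees L₀-cd))

    K'-size : size K' ≡ suc (size L)
    K'-size = Matching.size-after-insert G L L-matching b≢c
      (remove-keeps-absent L₀ c d (remove-keeps-absent H' a b (H-H'-disjoint b c Hbc)))

    H'-size : size H' ≡ suc (suc (size L))
    H'-size = trans (ℋ'.size-before-remove H'ab) (cong suc (ℒ₀.size-before-remove L₀-cd))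

    total : size K + size K' ≡ size H + size H'
    total rewrite K-size | K'-size | H'-size = ≡-sym (+-suc (size H) _)

    -- K₀ and L are disjoint parts of H and H'; the inserted edges are new.
    K-K'-disjoint : Disjoint K K'
    K-K'-disjoint = insert-disjointˡ K₁ K' c d K₁-K'-disjoint
      (insert-absent L (not-endpointʳ (≢-sym b≢d) (≢-sym c≢d)) (remove-absent L₀ (inj₁ (refl , refl))))
      (insert-absent L (not-endpointˡ (≢-sym b≢d) (≢-sym c≢d)) (remove-absent L₀ (inj₂ (refl , refl))))
      where
      K₀-L-disjoint : Disjoint K₀ L
      K₀-L-disjoint = remove-disjointˡ H L b c
        (remove-disjointʳ H L₀ c d (remove-disjointʳ H H' a b H-H'-disjoint))
      K₁-K'-disjoint : Disjoint K₁ K'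
      K₁-K'-disjoint = insert-disjointˡ K₀ K' a b
        (insert-disjointʳ K₀ L b c K₀-L-disjoint
          (remove-absent H (inj₁ (refl , refl))) (remove-absent H (inj₂ (refl , refl))))
        (insert-absent L (not-endpointˡ a≢b a≢c) (remove-keeps-absent L₀ c d (remove-absent H' (inj₁ (refl , refl)))))
        (insert-absent L (not-endpointʳ a≢b a≢c) (remove-keeps-absent L₀ c d (remove-absent H' (inj₂ (refl , refl)))))

    impossible : ⊥
    impossible = no-larger-first (K-matching , K'-matching , K-K'-disjoint) total K-size

  no-free-M-H-M-path : ∀ {a b c d} → M a b ≡ true → H b c ≡ true → M c d ≡ true →
    Uncovered H a → Uncovered H d → ⊥
  no-free-M-H-M-path Mab Hbc Mcd free-a free-d = Rotation.impossible Mab Hbc Mcd free-a free-d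

EvenLength : ∀ {A : Set} → List A → Set
EvenLength []           = ⊤
EvenLength (_ ∷ [])     = ⊥
EvenLength (_ ∷ _ ∷ xs) = EvenLength xs

even-length : ∀ {A : Set} (xs : List A) (l : ℕ) → length xs ≡ 2 * l → EvenLength xs
even-length []           _       _   = tt
even-length (_ ∷ [])     zero    ()
even-length (_ ∷ [])     (suc l) len with () ← trans len (*-suc 2 l)
even-length (_ ∷ _ ∷ xs) zero    ()
even-length (_ ∷ _ ∷ xs) (suc l) len =
  even-length xs l (suc-injective (suc-injective (trans len (*-suc 2 l))))

lastOf : ∀ {A : Set} → A → List A → A
lastOf x []       = x
lastOf x (y ∷ ys) = lastOf y ys

lastOf-∈ : ∀ {A : Set} (x : A) (xs : List A) → lastOf x xs ∈ x ∷ xs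
lastOf-∈ x []       = here refl
lastOf-∈ x (y ∷ ys) = there (lastOf-∈ y ys)

-- An A-B alternating sequence with an odd number of edges ends with an
-- A-edge, so it can be prolonged by an edge of B ∖ A.
alt-snoc : ∀ {n} (A B : EdgeSet n) (u v : Fin n) (t : List (Fin n)) (z : Fin n) →
  EvenLength t → AltFrom A B (u ∷ v ∷ t) →
  B (lastOf v t) z ≡ true → A (lastOf v t) z ≡ false → AltFrom A B (u ∷ v ∷ t ++ z ∷ [])
alt-snoc A B u v [] z _ (Auv , Buv , _) Bvz Avz = Auv , Buv , Bvz , Avz , tt
alt-snoc A B u v (w ∷ x ∷ t) z even (Auv , Buv , Bvw , Avw , alt) Byz Ayz =
  Auv , Buv , Bvw , Avw , alt-snoc A B w x t z even alt Byz Ayz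

H-partner-inside : ∀ {n} (M H : EdgeSet n) → Symmetric H → (u : Fin n) (t : List (Fin n)) →
  EvenLength t → AltFrom H M (u ∷ t) → Unique (u ∷ t) → ∀ {w} → w ∈ u ∷ t →
  w ≡ lastOf u t ⊎ ∃[ z ] z ∈ u ∷ t × H w z ≡ true × z ≢ lastOf u t
H-partner-inside M H symm u [] _ _ _ (here refl) = inj₁ refl
H-partner-inside M H symm u (v ∷ x ∷ t) _ (Huv , _) (u∉ ∷ v∉ ∷ unique) (here refl) =
  inj₂ (v , there (here refl) , Huv , λ v≡y →
    Unique[x∷xs]⇒x∉xs (v∉ ∷ unique) (subst (_∈ x ∷ t) (≡-sym v≡y) (lastOf-∈ x t)))
H-partner-inside M H symm u (v ∷ x ∷ t) _ (Huv , _) (u∉ ∷ v∉ ∷ unique) (there (here refl)) =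
  inj₂ (u , here refl , trans (symm v u) Huv , λ u≡y →
    Unique[x∷xs]⇒x∉xs (u∉ ∷ v∉ ∷ unique) (subst (_∈ v ∷ x ∷ t) (≡-sym u≡y) (there (lastOf-∈ x t))))
H-partner-inside M H symm u (v ∷ x ∷ t) even (_ , _ , _ , _ , alt) (_ ∷ _ ∷ unique) (there (there w∈))
  with H-partner-inside M H symm x t even alt unique w∈
... | inj₁ w≡y                  = inj₁ w≡y
... | inj₂ (z , z∈ , Hwz , z≢y) = inj₂ (z , there (there z∈) , Hwz , z≢y)

last-M-partner : ∀ {n} (M H : EdgeSet n) (u v : Fin n) (t : List (Fin n)) → EvenLength t →
  AltFrom M H (u ∷ v ∷ t) → ∃[ x ] x ∈ u ∷ v ∷ t × M x (lastOf v t) ≡ true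
last-M-partner M H u v []          _    (Muv , _) = u , here refl , Muv
last-M-partner M H u v (w ∷ x ∷ t) even (_ , _ , _ , _ , alt)
  with last-M-partner M H w x t even alt
... | y , y∈ , Myl = y , there (there y∈) , Myl

record FinalSegment {n} (M H : EdgeSet n) (P : List (Fin n)) (y : Fin n) : Set where
  field
    p q       : Fin n
    H-pq      : H p q ≡ true
    M-qy      : M q y ≡ true
    last-edge : ∀ S → S q y ≡ true → LastEdgeIn S P

final-segment : ∀ {n} (M H : EdgeSet n) (u v w x : Fin n) (t : List (Fin n)) → EvenLength t →
  AltFrom M H (u ∷ v ∷ w ∷ x ∷ t) → FinalSegment M H (u ∷ v ∷ w ∷ x ∷ t) (lastOf x t)
final-segment M H u v w x [] _ (_ , _ , Hvw , _ , Mwx , _) =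
  record { p = v ; q = w ; H-pq = Hvw ; M-qy = Mwx ; last-edge = λ _ Swx → Swx }
final-segment M H u v w x (y ∷ z ∷ t) even (_ , _ , _ , _ , alt) =
  record { p = p ; q = q ; H-pq = H-pq ; M-qy = M-qy ; last-edge = last-edge }
  where open FinalSegment (final-segment M H w x y z t even alt)

module MaximalPath {n} (G : Graph n) (M H : EdgeSet n)
  (M-matching : IsMatching G M) (H-matching : IsMatching G H)
  {a b : Fin n} {r : List (Fin n)} (even : EvenLength r) (path : InMPoA M H (a ∷ b ∷ r)) where

  open import Data.List.Membership.DecPropositional (_≟_ {n}) using (_∈?_)
  private
    module ℳ = Matching G M M-matching
    module ℋ = Matching G H H-matching

  P : List (Fin n)
  P = a ∷ b ∷ r

  y : Fin n
  y = lastOf b r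

  alternating : AltFrom M H P
  alternating = proj₁ path

  unique : Unique P
  unique = proj₁ (proj₂ path)

  H-ab : H a b ≡ false
  H-ab = proj₁ (proj₂ alternating)

  not-extendable : ∀ Q → IsAltTrail M H Q → IsInfix P Q → length P < length Q → ⊥
  not-extendable Q trail inside longer = proj₂ (proj₂ (proj₂ path)) (Q , trail , inside , longer)

  longer-by-one : ∀ z → length P < length (P ++ z ∷ [])
  longer-by-one z = subst (length P <_) (≡-sym (length-++ P)) (m<m+n (length P) (s≤s z≤n))

  cannot-prepend : ∀ {z} → H z a ≡ true → M z a ≡ false → z ∉ P → ⊥
  cannot-prepend {z} Hza Mza z∉P = not-extendable (z ∷ P)
    (inj₂ (Hza , Mza , alternating) , inj₁ (¬Any⇒All¬ P z∉P ∷ unique))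
    (z ∷ [] , [] , cong (z ∷_) (≡-sym (++-identityʳ P))) (n<1+n (length P))

  cannot-append : ∀ {z} → H y z ≡ true → M y z ≡ false → z ∉ P → ⊥
  cannot-append {z} Hyz Myz z∉P = not-extendable (P ++ z ∷ [])
    (inj₁ (alt-snoc M H a b r z even alternating Hyz Myz) ,
     inj₁ (++⁺ unique ([] ∷ []) λ { (z∈P , here refl) → z∉P z∈P }))
    ([] , z ∷ [] , refl) (longer-by-one z)

  cannot-close : H y a ≡ true → M y a ≡ false → ⊥
  cannot-close Hya Mya = not-extendable (P ++ a ∷ [])
    (inj₁ (alt-snoc M H a b r a even alternating Hya Mya) ,
     inj₂ (a , b ∷ r , refl , unique , proj₁ (proj₂ (proj₂ path))))
    ([] , a ∷ [] , refl) (longer-by-one a)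

  -- An H-neighbour z of a is not M-matched to a, as a is M-matched to b ∉ H.
  M-absent-at-H-neighbour : ∀ {z} → H a z ≡ true → M z a ≡ false
  M-absent-at-H-neighbour {z} Haz = ℳ.flip-absent (ℳ.other-absent (proj₁ alternating)
    λ z≡b → not-¬ (subst (λ v → H a v ≡ true) z≡b Haz) H-ab)

  -- An H-edge at a could only prolong P, close it into a cycle, or hit an
  -- inner vertex, which is already H-matched inside P.
  first-free : Uncovered H a
  first-free z = ¬-not (no-H-edge z)
    where
    no-H-edge : ∀ z → H a z ≢ true
    no-H-edge z Haz with z ∈? P
    ... | no z∉P = cannot-prepend (ℋ.flip Haz) (M-absent-at-H-neighbour Haz) z∉P
    ... | yes (here refl) = ℋ.ends-distinct Haz refl
    ... | yes (there z∈)
      with H-partner-inside M H ℋ.symmetric b r even (proj₂ (proj₂ alternating)) (drop⁺ 1 unique) z∈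
    ...   | inj₁ refl = cannot-close (ℋ.flip Haz) (M-absent-at-H-neighbour Haz)
    ...   | inj₂ (w , w∈ , Hzw , _) = Unique[x∷xs]⇒x∉xs unique
      (subst (_∈ b ∷ r) (≡-sym (ℋ.partner-unique z a w (ℋ.flip Haz) Hzw)) w∈)

  -- Symmetrically at the last vertex y, whose M-partner x lies on P.
  last-free : Uncovered H y
  last-free = free-given-partner (last-M-partner M H a b r even alternating)
    where
    free-given-partner : ∃[ x ] x ∈ P × M x y ≡ true → Uncovered H y
    free-given-partner (x , x∈P , M-xy) z = ¬-not (no-H-edge z)
      where
      no-H-edge : ∀ z → H y z ≢ true
      no-H-edge z Hyz with z ∈? P
      ... | no z∉P = cannot-append Hyz (ℳ.other-absent (ℳ.flip M-xy) λ { refl → z∉P x∈P }) z∉P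
      ... | yes (here refl) = cannot-close Hyz (M-absent-at-H-neighbour (ℋ.flip Hyz))
      ... | yes (there z∈)
        with H-partner-inside M H ℋ.symmetric b r even (proj₂ (proj₂ alternating)) (drop⁺ 1 unique) z∈
      ...   | inj₁ refl = ℋ.ends-distinct Hyz refl
      ...   | inj₂ (w , _ , Hzw , w≢y) = w≢y (≡-sym (ℋ.partner-unique z y w (ℋ.flip Hyz) Hzw))

free-ends : ∀ {n} (G : Graph n) (M H : EdgeSet n) → IsMatching G M → IsMatching G H →
  ∀ {a b r} → EvenLength r → InMPoA M H (a ∷ b ∷ r) → Uncovered H a × Uncovered H (lastOf b r)
free-ends G M H M-matching H-matching even path = first-free , last-free
  where open MaximalPath G M H M-matching H-matching even path

ends-in-H' : ∀ {n} (G : Graph n) (M H H' : EdgeSet n) → IsMatching G M → InM₂M G M H H' →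
  ∀ {a b c d r} → EvenLength r → InMPoA M H (a ∷ b ∷ c ∷ d ∷ r) →
  FirstEdgeIn H' (a ∷ b ∷ c ∷ d ∷ r) × LastEdgeIn H' (a ∷ b ∷ c ∷ d ∷ r)
ends-in-H' G M H H' M-matching optimal {a} {b} {c} {d} {r} even path =
  pendant-in-H' (proj₁ alternating) (proj₁ (proj₂ (proj₂ alternating))) free-first ,
  last-edge H' (ℋ'.flip (pendant-in-H' (ℳ.flip M-qy) (ℋ.flip H-pq) free-last))
  where
  open Optimal G M H H' optimal using (in-B₂)
  open Exchange G M H H' M-matching optimal using (pendant-in-H')
  module ℳ  = Matching G M M-matching
  module ℋ  = Matching G H (proj₁ in-B₂)
  module ℋ' = Matching G H' (proj₁ (proj₂ in-B₂))
  alternating : AltFrom M H (a ∷ b ∷ c ∷ d ∷ r)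
  alternating = proj₁ path
  open FinalSegment (final-segment M H a b c d r even alternating)
  free-first : Uncovered H a
  free-first = proj₁ (free-ends G M H M-matching (proj₁ in-B₂) even path)
  free-last : Uncovered H (lastOf d r)
  free-last = proj₂ (free-ends G M H M-matching (proj₁ in-B₂) even path)

-- Lemma 3.1: every P ∈ MP_o^M(M , H) with l M-edges starts and ends with an
-- edge of H', and has l ≥ 3.  A path with l = 1 is a single M-edge with
-- H-free ends; one with l = 2 is an M-H-M path with H-free ends.
lemma3p1 : ∀ {n} (G : Graph n) (M H H' : EdgeSet n) →
    IsMaximumMatching G M → InM₂M G M H H' →
    (P : List (Fin n)) → InMPoA M H P →
    (l : ℕ) → length P ≡ 2 * l →
    (FirstEdgeIn H' P × LastEdgeIn H' P) × 3 ≤ l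
lemma3p1 G M H H' maximum optimal [] (() , _) l len
lemma3p1 G M H H' maximum optimal P@(_ ∷ []) path l len = ⊥-elim (even-length P l len)
lemma3p1 G M H H' maximum optimal P@(_ ∷ _ ∷ _ ∷ []) path l len = ⊥-elim (even-length P l len)
lemma3p1 G M H H' maximum optimal (a ∷ b ∷ []) path l len =
  ⊥-elim (no-free-M-edge Mab (proj₁ free) (proj₂ free))
  where
  open Exchange G M H H' (proj₁ maximum) optimal
  Mab : M a b ≡ true
  Mab = proj₁ (proj₁ path)
  free : Uncovered H a × Uncovered H b
  free = free-ends G M H (proj₁ maximum) (proj₁ (Optimal.in-B₂ G M H H' optimal)) tt path
lemma3p1 G M H H' maximum optimal (a ∷ b ∷ c ∷ d ∷ []) path l len =
  ⊥-elim (no-free-M-H-M-path Mab Hbc Mcd (proj₁ free) (proj₂ free))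
  where
  open Exchange G M H H' (proj₁ maximum) optimal
  Mab : M a b ≡ true
  Mab = proj₁ (proj₁ path)
  Hbc : H b c ≡ true
  Hbc = proj₁ (proj₂ (proj₂ (proj₁ path)))
  Mcd : M c d ≡ true
  Mcd = proj₁ (proj₂ (proj₂ (proj₂ (proj₂ (proj₁ path)))))
  free : Uncovered H a × Uncovered H d
  free = free-ends G M H (proj₁ maximum) (proj₁ (Optimal.in-B₂ G M H H' optimal)) tt path
lemma3p1 G M H H' maximum optimal P@(_ ∷ _ ∷ _ ∷ _ ∷ _ ∷ _) path l len =
  ends-in-H' G M H H' (proj₁ maximum) optimal (even-length P l len) path , three-≤ l len
  where
  three-≤ : ∀ l → length P ≡ 2 * l → 3 ≤ l
  three-≤ (suc (suc (suc _))) _ = s≤s (s≤s (s≤s z≤n))
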